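{- Let $D=(V,E)$ be a strongly connected balanced digraph. Suppose that $r_{ij}^D\le 1$ for every arc $(i,j)\in E$. Then $r_{ij}^D \le d_{ij}^D$ for all $i,j\in V$.
   Context: All digraphs are finite, without loops or multiple arcs. A digraph is balanced if every vertex has indegree equal to outdegree, and strongly connected if there is a directed path from any vertex to any other. For $D$ on vertex set $\{1,\dots,n\}$, the Laplacian $L=(l_{ij})$ has $l_{ii}$ equal to the outdegree of $i$, $l_{ij}=-1$ if $(i,j)\in E$, and $l_{ij}=0$ otherwise; $L^{\dagger}=(l^{\dagger}_{ij})$ is its Moore–Penrose inverse, and the resistance distance is $r_{ij}^D = l^{\dagger}_{ii}+l^{\dagger}_{jj}-2l^{\dagger}_{ij}$. $d_{ij}^D$ is the length of a shortest directed path from $i$ to $j$ in $D$. -}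

module Defs where

open import Data.Nat as ℕ using (ℕ; zero; suc)
open import Data.Integer using (+_)
open import Data.Fin as F using (Fin; _≟_)
open import Relation.Nullary.Decidable using (does)
open import Data.Bool using (Bool; true; false; if_then_else_)
open import Data.Product using (Σ; _×_; ∃)
open import Relation.Nullary using (¬_)
open import Relation.Binary.PropositionalEquality using (_≡_)
open import Data.Rational using (ℚ; 0ℚ; 1ℚ; _+_; _*_; _-_; -_; _/_)

Digraph : ℕ → Set
Digraph n = Fin n → Fin n → Bool

-- No loops (multiple arcs are excluded automatically by the Bool representation).
Loopless : ∀ {n} → Digraph n → Set
Loopless {n} E = (i : Fin n) → E i i ≡ false

∑ : ∀ {A : Set} (z : A) (_⊕_ : A → A → A) (n : ℕ) → (Fin n → A) → A
∑ z _⊕_ zero    f = z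
∑ z _⊕_ (suc n) f = f F.zero ⊕ ∑ z _⊕_ n (λ i → f (F.suc i))

∑ℕ : (n : ℕ) → (Fin n → ℕ) → ℕ
∑ℕ = ∑ 0 ℕ._+_

∑ℚ : (n : ℕ) → (Fin n → ℚ) → ℚ
∑ℚ = ∑ 0ℚ _+_

b2ℕ : Bool → ℕ
b2ℕ true  = 1
b2ℕ false = 0

outdeg : ∀ {n} → Digraph n → Fin n → ℕ
outdeg {n} E i = ∑ℕ n (λ j → b2ℕ (E i j))

indeg : ∀ {n} → Digraph n → Fin n → ℕ
indeg {n} E j = ∑ℕ n (λ i → b2ℕ (E i j))

Balanced : ∀ {n} → Digraph n → Set
Balanced {n} E = (i : Fin n) → outdeg E i ≡ indeg E i

data Walk {n : ℕ} (E : Digraph n) : Fin n → Fin n → ℕ → Set where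
  here  : ∀ {i} → Walk E i i 0
  step  : ∀ {i j k m} → E i j ≡ true → Walk E j k m → Walk E i k (suc m)

StronglyConnected : ∀ {n} → Digraph n → Set
StronglyConnected {n} E = (i j : Fin n) → ∃ λ m → Walk E i j m

-- d is the length of a shortest directed path (equivalently walk) from i to j.
IsDistance : ∀ {n} → Digraph n → Fin n → Fin n → ℕ → Set
IsDistance E i j d = Walk E i j d × (∀ m → m ℕ.< d → ¬ Walk E i j m)

Mat : ℕ → Set
Mat n = Fin n → Fin n → ℚ

_·_ : ∀ {n} → Mat n → Mat n → Mat n
_·_ {n} A B i j = ∑ℚ n (λ k → A i k * B k j)

transpose : ∀ {n} → Mat n → Mat n
transpose A i j = A j i

ℕtoℚ : ℕ → ℚ
ℕtoℚ k = + k / 1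

-- Laplacian: l_ii = outdeg i, l_ij = -1 if (i,j) ∈ E, 0 otherwise (i ≠ j; loopless).
Laplacian : ∀ {n} → Digraph n → Mat n
Laplacian E i j =
  ℕtoℚ (if does (i ≟ j) then outdeg E i else 0) - (if E i j then 1ℚ else 0ℚ)

-- X is the Moore–Penrose inverse of A (the four Penrose conditions; over ℚ
-- the conjugate transpose is the transpose).  Such X is unique.
IsMoorePenroseInverse : ∀ {n} → Mat n → Mat n → Set
IsMoorePenroseInverse {n} A X =
    (∀ i j → ((A · X) · A) i j ≡ A i j)
  × (∀ i j → ((X · A) · X) i j ≡ X i j)
  × (∀ i j → transpose (A · X) i j ≡ (A · X) i j)
  × (∀ i j → transpose (X · A) i j ≡ (X · A) i j)

resistance : ∀ {n} → Mat n → Fin n → Fin n → ℚ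
resistance X i j = X i i + X j j - (ℕtoℚ 2 * X i j)

-- Let L be the Laplacian and X its Moore–Penrose inverse. On a strongly
-- connected digraph a function g with (L g)ᵢ ≥ 0 for all i ≠ j attains its
-- minimum at j (follow a path from a minimiser to j: L g ≥ 0 forces every
-- out-neighbour of a minimiser to be a minimiser). For balanced D, Lᵀ is the
-- Laplacian of the reversed digraph, so the left kernel of L is the constants;
-- with L X L = L and (L X)ᵀ = L X this gives (L X)ᵢₖ − (L X)ᵢⱼ = δₖᵢ ≥ 0 for
-- i ≠ j. Hence g = X₋ₖ − X₋ⱼ attains its minimum at j, and
-- 2 (gᵢ − gⱼ) = rᵢⱼ + rⱼₖ − rᵢₖ is the triangle inequality for r. Summing the
-- arc bound r ≤ 1 along a shortest path then gives rᵢⱼ ≤ dᵢⱼ.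
module Submission where

open import Defs
open import Data.Bool using (Bool; true; false; if_then_else_)
open import Data.Empty using (⊥-elim)
open import Data.Fin using (Fin; zero; suc; _≟_)
open import Data.Fin.Properties using (suc-injective)
import Data.Integer as ℤ
import Data.Integer.Properties as ℤ
open import Data.List using (allFin)
open import Data.List.Membership.Propositional.Properties using (∈-allFin)
open import Data.List.Relation.Unary.All using (lookup)
open import Data.Nat as ℕ using (ℕ; suc)
import Data.Nat.Coprimality as Coprime
open import Data.Product using (∃; _,_; proj₁; proj₂)
open import Data.Rational as ℚ using (ℚ; 0ℚ; 1ℚ; mkℚ; _+_; _*_; _-_; -_; _≤_)
open import Data.Rational.Properties as ℚ
  using (≤-refl; ≤-reflexive; ≤-trans; ≤-antisym; +-mono-≤; +-monoʳ-≤; +-monoˡ-≤)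
open import Data.Rational.Solver using (module +-*-Solver)
import Data.Rational.Unnormalised as ℚᵘ
import Data.Rational.Unnormalised.Properties as ℚᵘ
open import Function using (_∘_)
open import Relation.Binary.Bundles using (DecTotalOrder)
open import Relation.Binary.PropositionalEquality
  using (_≡_; _≢_; refl; sym; trans; cong; cong₂; subst; module ≡-Reasoning)
open import Relation.Nullary using (yes; no)
open import Relation.Nullary.Decidable using (does; dec-true; dec-false)

open import Algebra.Properties.Group ℚ.+-0-group using (x∙y⁻¹≈ε⇒x≈y)
open import Data.List.Extrema (DecTotalOrder.totalOrder ℚ.≤-decTotalOrder) using (argmin; f[argmin]≤f[xs])

open +-*-Solver

private
  variable
    n : ℕ

ℕtoℚ≡mkℚ : ∀ k → ℕtoℚ k ≡ mkℚ (ℤ.+ k) 0 (Coprime.sym (Coprime.1-coprimeTo k))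
ℕtoℚ≡mkℚ k = ℚ.normalize-coprime (Coprime.sym (Coprime.1-coprimeTo k))

ℕtoℚ-+ : ∀ a b → ℕtoℚ (a ℕ.+ b) ≡ ℕtoℚ a + ℕtoℚ b
ℕtoℚ-+ a b = ℚ.toℚᵘ-injective (begin
  ℚ.toℚᵘ (ℕtoℚ (a ℕ.+ b))
    ≈⟨ ℚᵘ.≃-reflexive (cong ℚ.toℚᵘ (ℕtoℚ≡mkℚ (a ℕ.+ b))) ⟩
  ℚᵘ.mkℚᵘ (ℤ.+ (a ℕ.+ b)) 0
    ≈⟨ ℚᵘ.*≡* (cong (ℤ._* ℤ.+ 1) (sym (cong₂ ℤ._+_ (ℤ.*-identityʳ (ℤ.+ a)) (ℤ.*-identityʳ (ℤ.+ b))))) ⟩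
  ℚᵘ.mkℚᵘ (ℤ.+ a) 0 ℚᵘ.+ ℚᵘ.mkℚᵘ (ℤ.+ b) 0
    ≡⟨ cong₂ (λ p q → ℚ.toℚᵘ p ℚᵘ.+ ℚ.toℚᵘ q) (ℕtoℚ≡mkℚ a) (ℕtoℚ≡mkℚ b) ⟨
  ℚ.toℚᵘ (ℕtoℚ a) ℚᵘ.+ ℚ.toℚᵘ (ℕtoℚ b)
    ≈⟨ ℚ.toℚᵘ-homo-+ (ℕtoℚ a) (ℕtoℚ b) ⟨
  ℚ.toℚᵘ (ℕtoℚ a + ℕtoℚ b) ∎)
  where open ℚᵘ.≃-Reasoning

ℕtoℚ-nonNeg : ∀ k → 0ℚ ≤ ℕtoℚ k
ℕtoℚ-nonNeg k = ℚ.nonNegative⁻¹ (ℕtoℚ k) {{ℚ.normalize-nonNeg k 1}}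

p≤q⇒p-q≤0 : ∀ {p q} → p ≤ q → p - q ≤ 0ℚ
p≤q⇒p-q≤0 {p} {q} p≤q = subst (p - q ≤_) (ℚ.+-inverseʳ q) (+-monoˡ-≤ (- q) p≤q)

p≤q⇒0≤q-p : ∀ {p q} → p ≤ q → 0ℚ ≤ q - p
p≤q⇒0≤q-p {p} {q} p≤q = subst (_≤ q - p) (ℚ.+-inverseʳ p) (+-monoˡ-≤ (- p) p≤q)

p-q≡0⇒p≡q : ∀ {p q} → p - q ≡ 0ℚ → p ≡ q
p-q≡0⇒p≡q = x∙y⁻¹≈ε⇒x≈y _ _

χ : Bool → ℚ
χ b = if b then 1ℚ else 0ℚ

χ≡ℕtoℚ∘b2ℕ : ∀ b → χ b ≡ ℕtoℚ (b2ℕ b)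
χ≡ℕtoℚ∘b2ℕ true  = refl
χ≡ℕtoℚ∘b2ℕ false = refl

χ*-nonPos : ∀ b {p} → p ≤ 0ℚ → χ b * p ≤ 0ℚ
χ*-nonPos true  {p} p≤0 = subst (_≤ 0ℚ) (sym (ℚ.*-identityˡ p)) p≤0
χ*-nonPos false {p} _   = ≤-reflexive (ℚ.*-zeroˡ p)

∑ℚ-cong : ∀ n {f g : Fin n → ℚ} → (∀ i → f i ≡ g i) → ∑ℚ n f ≡ ∑ℚ n g
∑ℚ-cong 0       f≗g = refl
∑ℚ-cong (suc n) f≗g = cong₂ _+_ (f≗g zero) (∑ℚ-cong n (λ i → f≗g (suc i)))

∑ℚ-distrib-- : ∀ n (f g : Fin n → ℚ) → ∑ℚ n (λ i → f i - g i) ≡ ∑ℚ n f - ∑ℚ n g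
∑ℚ-distrib-- 0       f g = refl
∑ℚ-distrib-- (suc n) f g = trans
  (cong ((f zero - g zero) +_) (∑ℚ-distrib-- n (λ i → f (suc i)) (λ i → g (suc i))))
  (solve 4 (λ a b s t → (a :- b) :+ (s :- t) := (a :+ s) :- (b :+ t)) refl
     (f zero) (g zero) (∑ℚ n (λ i → f (suc i))) (∑ℚ n (λ i → g (suc i))))

∑ℚ-*ʳ : ∀ n (f : Fin n → ℚ) c → ∑ℚ n (λ i → f i * c) ≡ ∑ℚ n f * c
∑ℚ-*ʳ 0       f c = sym (ℚ.*-zeroˡ c)
∑ℚ-*ʳ (suc n) f c = trans
  (cong (f zero * c +_) (∑ℚ-*ʳ n (λ i → f (suc i)) c))
  (sym (ℚ.*-distribʳ-+ c (f zero) (∑ℚ n (λ i → f (suc i)))))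

∑ℚ-ℕtoℚ : ∀ n (f : Fin n → ℕ) → ∑ℚ n (λ i → ℕtoℚ (f i)) ≡ ℕtoℚ (∑ℕ n f)
∑ℚ-ℕtoℚ 0       f = refl
∑ℚ-ℕtoℚ (suc n) f = trans
  (cong (ℕtoℚ (f zero) +_) (∑ℚ-ℕtoℚ n (λ i → f (suc i))))
  (sym (ℕtoℚ-+ (f zero) (∑ℕ n (λ i → f (suc i)))))

∑ℚ-zero : ∀ n (f : Fin n → ℚ) → (∀ i → f i ≡ 0ℚ) → ∑ℚ n f ≡ 0ℚ
∑ℚ-zero 0       f f≗0 = refl
∑ℚ-zero (suc n) f f≗0 = cong₂ _+_ (f≗0 zero) (∑ℚ-zero n (λ i → f (suc i)) (λ i → f≗0 (suc i)))

∑ℚ-single : ∀ n (f : Fin n → ℚ) k → (∀ i → i ≢ k → f i ≡ 0ℚ) → ∑ℚ n f ≡ f k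
∑ℚ-single (suc n) f zero    f≗0 = trans
  (cong (f zero +_) (∑ℚ-zero n (λ i → f (suc i)) (λ i → f≗0 (suc i) (λ ()))))
  (ℚ.+-identityʳ (f zero))
∑ℚ-single (suc n) f (suc k) f≗0 = trans
  (cong₂ _+_ (f≗0 zero (λ ())) (∑ℚ-single n (λ i → f (suc i)) k (λ i i≢k → f≗0 (suc i) (i≢k ∘ suc-injective))))
  (ℚ.+-identityˡ (f (suc k)))

∑ℚ-nonPos : ∀ n (f : Fin n → ℚ) → (∀ i → f i ≤ 0ℚ) → ∑ℚ n f ≤ 0ℚ
∑ℚ-nonPos 0       f f≤0 = ≤-refl
∑ℚ-nonPos (suc n) f f≤0 = +-mono-≤ (f≤0 zero) (∑ℚ-nonPos n (λ i → f (suc i)) (λ i → f≤0 (suc i)))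

∑ℚ-nonPos-zero : ∀ n (f : Fin n → ℚ) → (∀ i → f i ≤ 0ℚ) → 0ℚ ≤ ∑ℚ n f → ∀ i → f i ≡ 0ℚ
∑ℚ-nonPos-zero (suc n) f f≤0 0≤∑ = λ where
    zero    → ≤-antisym (f≤0 zero) (≤-trans 0≤∑ head≥∑)
    (suc i) → ∑ℚ-nonPos-zero n (λ i → f (suc i)) (λ i → f≤0 (suc i)) (≤-trans 0≤∑ tail≥∑) i
  where
  S = ∑ℚ n (λ i → f (suc i))
  head≥∑ : f zero + S ≤ f zero
  head≥∑ = subst (f zero + S ≤_) (ℚ.+-identityʳ (f zero)) (+-monoʳ-≤ (f zero) (∑ℚ-nonPos n (λ i → f (suc i)) (λ i → f≤0 (suc i))))
  tail≥∑ : f zero + S ≤ S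
  tail≥∑ = subst (f zero + S ≤_) (ℚ.+-identityˡ S) (+-monoˡ-≤ S (f≤0 zero))

∑ℚ-diagonal : ∀ (a : Fin n) k (g : Fin n → ℚ) →
              ∑ℚ n (λ b → ℕtoℚ (if does (a ≟ b) then k else 0) * g b) ≡ ℕtoℚ k * g a
∑ℚ-diagonal {n} a k g = trans
  (∑ℚ-single n _ a (λ b b≢a → trans (cong (λ t → ℕtoℚ (if t then k else 0) * g b) (dec-false (a ≟ b) (b≢a ∘ sym)))
                                 (ℚ.*-zeroˡ (g b))))
  (cong (λ t → ℕtoℚ (if t then k else 0) * g a) (dec-true (a ≟ a) refl))

reverse : Digraph n → Digraph n
reverse E i j = E j i

_▷_ : ∀ {E : Digraph n} {i j k m} → Walk E i j m → E j k ≡ true → Walk E i k (suc m)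
here        ▷ e = step e here
step e′ w   ▷ e = step e′ (w ▷ e)

reverse-walk : ∀ {E : Digraph n} {i j m} → Walk E i j m → Walk (reverse E) j i m
reverse-walk here       = here
reverse-walk (step e w) = reverse-walk w ▷ e

reverse-stronglyConnected : ∀ {E : Digraph n} → StronglyConnected E → StronglyConnected (reverse E)
reverse-stronglyConnected sc i j = let m , w = sc j i in m , reverse-walk w

_·ᵥ_ : Mat n → (Fin n → ℚ) → Fin n → ℚ
_·ᵥ_ {n} A g i = ∑ℚ n (λ b → A i b * g b)

Δ : Digraph n → (Fin n → ℚ) → Fin n → ℚ
Δ {n} E g i = ∑ℚ n (λ b → χ (E i b) * (g i - g b))

∑ℚ-χ : ∀ (F : Fin n → Bool) → ∑ℚ n (λ b → χ (F b)) ≡ ℕtoℚ (∑ℕ n (λ b → b2ℕ (F b)))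
∑ℚ-χ {n} F = trans (∑ℚ-cong n (λ b → χ≡ℕtoℚ∘b2ℕ (F b))) (∑ℚ-ℕtoℚ n (λ b → b2ℕ (F b)))

Laplacian-action : ∀ (E : Digraph n) g a → (Laplacian E ·ᵥ g) a ≡ Δ E g a
Laplacian-action {n} E g a = begin
  ∑ℚ n (λ b → (D b - χ (E a b)) * g b)
    ≡⟨ ∑ℚ-cong n (λ b → solve 3 (λ d c x → (d :- c) :* x := d :* x :- c :* x) refl (D b) (χ (E a b)) (g b)) ⟩
  ∑ℚ n (λ b → D b * g b - χ (E a b) * g b)
    ≡⟨ ∑ℚ-distrib-- n _ _ ⟩
  ∑ℚ n (λ b → D b * g b) - offDiagonal
    ≡⟨ cong (_- offDiagonal) (∑ℚ-diagonal a (outdeg E a) g) ⟩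
  ℕtoℚ (outdeg E a) * g a - offDiagonal
    ≡⟨ cong (λ d → d * g a - offDiagonal) (∑ℚ-χ (E a)) ⟨
  ∑ℚ n (λ b → χ (E a b)) * g a - offDiagonal
    ≡⟨ cong (_- offDiagonal) (∑ℚ-*ʳ n (λ b → χ (E a b)) (g a)) ⟨
  ∑ℚ n (λ b → χ (E a b) * g a) - offDiagonal
    ≡⟨ ∑ℚ-distrib-- n _ _ ⟨
  ∑ℚ n (λ b → χ (E a b) * g a - χ (E a b) * g b)
    ≡⟨ ∑ℚ-cong n (λ b → solve 3 (λ c x y → c :* x :- c :* y := c :* (x :- y)) refl (χ (E a b)) (g a) (g b)) ⟩
  Δ E g a ∎
  where
  open ≡-Reasoning
  D : Fin n → ℚ
  D b = ℕtoℚ (if does (a ≟ b) then outdeg E a else 0)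
  offDiagonal : ℚ
  offDiagonal = ∑ℚ n (λ b → χ (E a b) * g b)

Laplacian-reverse : ∀ {E : Digraph n} → Balanced E → ∀ i j → Laplacian (reverse E) i j ≡ Laplacian E j i
Laplacian-reverse {E = E} bal i j with i ≟ j | j ≟ i
... | yes refl | yes _ = cong (λ k → ℕtoℚ k - χ (E i i)) (sym (bal i))
... | yes refl | no i≢i = ⊥-elim (i≢i refl)
... | no i≢j   | yes refl = ⊥-elim (i≢j refl)
... | no _     | no _ = refl

minimiser : ∀ (g : Fin n → ℚ) → Fin n → ∃ λ a → ∀ k → g a ≤ g k
minimiser {n} g j = argmin g j (allFin n) , λ k → lookup (f[argmin]≤f[xs] j (allFin n)) (∈-allFin k)

minimum-spreads : ∀ (E : Digraph n) g {a b} → (∀ k → g a ≤ g k) → 0ℚ ≤ Δ E g a → E a b ≡ true → g a ≡ g b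
minimum-spreads {n} E g {a} {b} min 0≤Δ ab = p-q≡0⇒p≡q (begin
  g a - g b                    ≡⟨ sym (ℚ.*-identityˡ _) ⟩
  χ true * (g a - g b)         ≡⟨ cong (λ t → χ t * (g a - g b)) (sym ab) ⟩
  χ (E a b) * (g a - g b)      ≡⟨ ∑ℚ-nonPos-zero n _ term≤0 0≤Δ b ⟩
  0ℚ                           ∎)
  where
  open ≡-Reasoning
  term≤0 : ∀ c → χ (E a c) * (g a - g c) ≤ 0ℚ
  term≤0 c = χ*-nonPos (E a c) (p≤q⇒p-q≤0 (min c))

minimum-principle : ∀ {E : Digraph n} → StronglyConnected E → ∀ g j →
                    (∀ i → i ≢ j → 0ℚ ≤ Δ E g i) → ∀ k → g j ≤ g k
minimum-principle {E = E} sc g j superharmonic =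
  let a , a-min = minimiser g j in walk (proj₂ (sc a j)) a-min
  where
  walk : ∀ {i m} → Walk E i j m → (∀ k → g i ≤ g k) → ∀ k → g j ≤ g k
  walk here       i-min = i-min
  walk {i} (step ib w) i-min with i ≟ j
  ... | yes refl = i-min
  ... | no i≢j = walk w (λ k → subst (_≤ g k) (minimum-spreads E g i-min (superharmonic i i≢j) ib) (i-min k))

superharmonic-constant : ∀ {E : Digraph n} → StronglyConnected E → ∀ g →
                         (∀ i → 0ℚ ≤ Δ E g i) → ∀ a b → g a ≡ g b
superharmonic-constant sc g superharmonic a b = ≤-antisym (minimal a b) (minimal b a)
  where
  minimal : ∀ j k → g j ≤ g k
  minimal j = minimum-principle sc g j (λ i _ → superharmonic i)

𝟙 : Mat n
𝟙 i j = ℕtoℚ (if does (i ≟ j) then 1 else 0)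

𝟙-offDiagonal : ∀ {i j : Fin n} → i ≢ j → 𝟙 i j ≡ 0ℚ
𝟙-offDiagonal {i = i} {j} i≢j = cong (λ t → ℕtoℚ (if t then 1 else 0)) (dec-false (i ≟ j) i≢j)

𝟙-sym : ∀ (i j : Fin n) → 𝟙 i j ≡ 𝟙 j i
𝟙-sym i j with i ≟ j | j ≟ i
... | yes refl | yes _    = refl
... | yes refl | no i≢i   = ⊥-elim (i≢i refl)
... | no i≢j   | yes refl = ⊥-elim (i≢j refl)
... | no _     | no _     = refl

module _ {E : Digraph n} (bal : Balanced E) (sc : StronglyConnected E) where

  left-kernel-constant : ∀ u → (∀ m → ∑ℚ n (λ i → u i * Laplacian E i m) ≡ 0ℚ) → ∀ a b → u a ≡ u b
  left-kernel-constant u uL≡0 = superharmonic-constant (reverse-stronglyConnected sc) u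
    (λ m → ≤-reflexive (sym (begin
      Δ (reverse E) u m                             ≡⟨ Laplacian-action (reverse E) u m ⟨
      ∑ℚ n (λ i → Laplacian (reverse E) m i * u i)  ≡⟨ ∑ℚ-cong n (λ i → trans (cong (_* u i) (Laplacian-reverse bal m i)) (ℚ.*-comm (Laplacian E i m) (u i))) ⟩
      ∑ℚ n (λ i → u i * Laplacian E i m)            ≡⟨ uL≡0 m ⟩
      0ℚ                                            ∎)))
    where open ≡-Reasoning

  module _ {X : Mat n} (mp : IsMoorePenroseInverse (Laplacian E) X) where

    L P : Mat n
    L = Laplacian E
    P = L · X

    P-sym : ∀ i j → P i j ≡ P j i
    P-sym i j = sym (proj₁ (proj₂ (proj₂ mp)) i j)

    𝟙-P-column-constant : ∀ k a b → 𝟙 k a - P a k ≡ 𝟙 k b - P b k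
    𝟙-P-column-constant k = left-kernel-constant (λ i → 𝟙 k i - P i k) λ m → begin
      ∑ℚ n (λ i → (𝟙 k i - P i k) * L i m)
        ≡⟨ ∑ℚ-cong n (λ i → solve 3 (λ e p l → (e :- p) :* l := e :* l :- p :* l) refl (𝟙 k i) (P i k) (L i m)) ⟩
      ∑ℚ n (λ i → 𝟙 k i * L i m - P i k * L i m)
        ≡⟨ ∑ℚ-distrib-- n _ _ ⟩
      ∑ℚ n (λ i → 𝟙 k i * L i m) - ∑ℚ n (λ i → P i k * L i m)
        ≡⟨ cong₂ _-_ (∑ℚ-diagonal k 1 (λ i → L i m)) (∑ℚ-cong n (λ i → cong (_* L i m) (P-sym i k))) ⟩
      1ℚ * L k m - ((L · X) · L) k m
        ≡⟨ cong₂ _-_ (ℚ.*-identityˡ (L k m)) (proj₁ mp k m) ⟩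
      L k m - L k m
        ≡⟨ ℚ.+-inverseʳ (L k m) ⟩
      0ℚ ∎
      where open ≡-Reasoning

    P-offDiagonal : ∀ {i j} k → i ≢ j → P i k - P i j ≡ 𝟙 k i
    P-offDiagonal {i} {j} k i≢j = begin
      P i k - P i j
        ≡⟨ solve 4 (λ a b p q → p :- q := (a :- (a :- p)) :- (b :- (b :- q))) refl (𝟙 k i) (𝟙 j i) (P i k) (P i j) ⟩
      (𝟙 k i - (𝟙 k i - P i k)) - (𝟙 j i - (𝟙 j i - P i j))
        ≡⟨ cong₂ (λ c d → (𝟙 k i - c) - (𝟙 j i - d)) (𝟙-P-column-constant k i j) column-j ⟩
      (𝟙 k i - (𝟙 k j - P j k)) - (𝟙 j i - (𝟙 k j - P j k))
        ≡⟨ cong (λ e → (𝟙 k i - (𝟙 k j - P j k)) - (e - (𝟙 k j - P j k))) (𝟙-offDiagonal (i≢j ∘ sym)) ⟩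
      (𝟙 k i - (𝟙 k j - P j k)) - (0ℚ - (𝟙 k j - P j k))
        ≡⟨ solve 2 (λ a c → (a :- c) :- (con 0ℚ :- c) := a) refl (𝟙 k i) (𝟙 k j - P j k) ⟩
      𝟙 k i ∎
      where
      open ≡-Reasoning
      column-j : 𝟙 j i - P i j ≡ 𝟙 k j - P j k
      column-j = trans (𝟙-P-column-constant j i k) (cong₂ _-_ (𝟙-sym j k) (P-sym k j))

    resistance-triangle : ∀ i j k → resistance X i k ≤ resistance X i j + resistance X j k
    resistance-triangle i j k = begin
      r i k                    ≡⟨ ℚ.+-identityʳ (r i k) ⟨
      r i k + 0ℚ               ≤⟨ +-monoʳ-≤ (r i k) (+-mono-≤ 0≤gi-gj 0≤gi-gj) ⟩
      r i k + (gi-gj + gi-gj)  ≡⟨ solve 6 (λ ii jj kk ij jk ik →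
                                    (ii :+ kk :- (con 1ℚ :+ con 1ℚ) :* ik) :+ ((ik :- ij :- (jk :- jj)) :+ (ik :- ij :- (jk :- jj)))
                                    := (ii :+ jj :- (con 1ℚ :+ con 1ℚ) :* ij) :+ (jj :+ kk :- (con 1ℚ :+ con 1ℚ) :* jk))
                                  refl (X i i) (X j j) (X k k) (X i j) (X j k) (X i k) ⟩
      r i j + r j k            ∎
      where
      open ℚ.≤-Reasoning
      r = resistance X
      g : Fin n → ℚ
      g b = X b k - X b j
      gi-gj = g i - g j
      Δg≡P : ∀ a → Δ E g a ≡ P a k - P a j
      Δg≡P a = begin-equality
        Δ E g a                                          ≡⟨ Laplacian-action E g a ⟨
        ∑ℚ n (λ b → L a b * (X b k - X b j))             ≡⟨ ∑ℚ-cong n (λ b → solve 3 (λ l p q → l :* (p :- q) := l :* p :- l :* q) refl (L a b) (X b k) (X b j)) ⟩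
        ∑ℚ n (λ b → L a b * X b k - L a b * X b j)       ≡⟨ ∑ℚ-distrib-- n _ _ ⟩
        P a k - P a j                                    ∎
      0≤gi-gj : 0ℚ ≤ gi-gj
      0≤gi-gj = p≤q⇒0≤q-p (minimum-principle sc g j
        (λ a a≢j → subst (0ℚ ≤_) (sym (trans (Δg≡P a) (P-offDiagonal k a≢j))) (ℕtoℚ-nonNeg (if does (k ≟ a) then 1 else 0))) i)

walk-length-bound : ∀ {E : Digraph n} (ρ : Fin n → Fin n → ℚ) → (∀ i → ρ i i ≡ 0ℚ) →
                    (∀ i j k → ρ i k ≤ ρ i j + ρ j k) → (∀ i j → E i j ≡ true → ρ i j ≤ 1ℚ) →
                    ∀ {i j m} → Walk E i j m → ρ i j ≤ ℕtoℚ m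
walk-length-bound ρ ρ-diag triangle arc here = ≤-reflexive (ρ-diag _)
walk-length-bound ρ ρ-diag triangle arc (step {i} {j} {k} {m} ij w) = begin
  ρ i k            ≤⟨ triangle i j k ⟩
  ρ i j + ρ j k    ≤⟨ +-mono-≤ (arc i j ij) (walk-length-bound ρ ρ-diag triangle arc w) ⟩
  1ℚ + ℕtoℚ m      ≡⟨ ℕtoℚ-+ 1 m ⟨
  ℕtoℚ (suc m)     ∎
  where open ℚ.≤-Reasoning

resistance-diagonal : ∀ (X : Mat n) i → resistance X i i ≡ 0ℚ
resistance-diagonal X i = solve 1 (λ x → x :+ x :- (con 1ℚ :+ con 1ℚ) :* x := con 0ℚ) refl (X i i)

lemma2p5 : (n : ℕ) (E : Digraph n) → Loopless E → StronglyConnected E → Balanced E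
    → (Ldag : Mat n) → IsMoorePenroseInverse (Laplacian E) Ldag
    → ((i j : Fin n) → E i j ≡ true → resistance Ldag i j ≤ 1ℚ)
    → (i j : Fin n) (d : ℕ) → IsDistance E i j d → resistance Ldag i j ≤ ℕtoℚ d
lemma2p5 n E _ sc bal X mp arc≤1 i j d (shortest-walk , _) =
  walk-length-bound (resistance X) (resistance-diagonal X) (resistance-triangle bal sc mp) arc≤1 shortest-walk
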